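{- Let $\mathcal{H}$ be a set of sequents and $\Pi\to B$ a sequent, all in the product-free language (built using only $\backslash$, $/$, $\wedge$, $\mathbf{0}$, $\mathbf{1}$). If $\Pi\to B$ is derivable from $\mathcal{H}$ in $\mathbf{L}^{\Lambda}\wedge\mathbf{0}\mathbf{1}$, then $\Pi\to B$ is derivable from $\mathcal{H}$ in $\mathbf{L}^{\Lambda}_{\backslash,/}\wedge\mathbf{0}\mathbf{1}$. Moreover, if $\mathcal{H}$ and $\Pi\to B$ additionally contain no occurrences of $\mathbf{0}$ and $\mathbf{1}$, then $\Pi\to B$ is derivable from $\mathcal{H}$ in $\mathbf{L}^{\Lambda}_{\backslash,/}\wedge$.
   Context: Formulae are built from a countable set of propositional variables and the constants $\mathbf{0}$ and $\mathbf{1}$ using the binary connectives $\cdot$, $\backslash$, $/$, $\wedge$. A sequent is $\Pi \to B$ with $B$ a formula and $\Pi$ a finite, possibly empty, sequence of formulae (empty sequence written $\Lambda$). The calculus $\mathbf{L}^{\Lambda}\wedge\mathbf{0}\mathbf{1}$ has the axioms $A \to A$, $\Gamma,\mathbf{0},\Delta \to C$ and $\Lambda \to \mathbf{1}$, and rules (capital Greek letters denote possibly empty sequences): (Cut) from $\Pi \to A$ and $\Gamma, A, \Delta \to C$ infer $\Gamma,\Pi,\Delta\to C$; ($\backslash L$) from $\Pi\to A$ and $\Gamma,B,\Delta\to C$ infer $\Gamma,\Pi,A\backslash B,\Delta\to C$; ($\backslash R$) from $A,\Pi\to B$ infer $\Pi\to A\backslash B$; ($/ L$) from $\Pi\to A$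 and $\Gamma,B,\Delta\to C$ infer $\Gamma,B/A,\Pi,\Delta\to C$; ($/R$) from $\Pi,A\to B$ infer $\Pi\to B/A$; ($\cdot L$) from $\Gamma,A,B,\Delta\to C$ infer $\Gamma,A\cdot B,\Delta\to C$; ($\cdot R$) from $\Pi\to A$ and $\Delta\to B$ infer $\Pi,\Delta\to A\cdot B$; ($\wedge L$) from $\Gamma,A,\Delta\to C$ infer both $\Gamma,A\wedge B,\Delta\to C$ and $\Gamma,B\wedge A,\Delta\to C$; ($\wedge R$) from $\Pi\to A$ and $\Pi\to B$ infer $\Pi\to A\wedge B$; ($\mathbf{1} L$) from $\Gamma,\Delta\to C$ infer $\Gamma,\mathbf{1},\Delta\to C$. The calculus $\mathbf{L}^{\Lambda}_{\backslash,/}\wedge\mathbf{0}\mathbf{1}$ is obtained (in the product-free language) by removing the rules $\cdot L$ and $\cdot R$; the calculus $\mathbf{L}^{\Lambda}_{\backslash,/}\wedge$ (in the language of $\backslash,/,\wedge$ only) is obtained by further removing the axioms $\Gamma,\mathbf{0},\Delta\to C$, $\Lambda\to\mathbf{1}$ and the rule $\mathbf{1}L$. A sequent is derivable from a set of sequents $\mathcal H$ in a calculus if it is derivable when the sequents of $\mathcal H$ are added as extra axioms (Cut being allowed). -}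

module Defs where

open import Data.Nat using (ℕ)
open import Data.List using (List; []; _∷_; _++_)
open import Data.List.Relation.Unary.All using (All)
open import Data.Bool using (Bool; true; false; T)
open import Data.Unit using (⊤)
open import Data.Empty using (⊥)
open import Data.Product using (_×_)

data Fm : Set where
  var  : ℕ → Fm
  𝟘 𝟙  : Fm
  _·_  : Fm → Fm → Fm
  _╲_  : Fm → Fm → Fm
  _╱_  : Fm → Fm → Fm
  _∧_  : Fm → Fm → Fm

record Sequent : Set where
  constructor _⇒_
  field
    ant  : List Fm
    succ : Fm

infix 4 _⇒_

record Lang : Set where
  field
    prod   : Bool
    consts : Bool
open Lang

InLang : Lang → Fm → Set
InLang L (var _) = ⊤
InLang L 𝟘 = T (consts L)
InLang L 𝟙 = T (consts L)
InLang L (A · B) = T (prod L) × InLang L A × InLang L B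
InLang L (A ╲ B) = InLang L A × InLang L B
InLang L (A ╱ B) = InLang L A × InLang L B
InLang L (A ∧ B) = InLang L A × InLang L B

SeqInLang : Lang → Sequent → Set
SeqInLang L (Π ⇒ B) = All (InLang L) Π × InLang L B

-- The three calculi, identified by their language:
--   L^Λ∧01          : prod = true,  consts = true
--   L^Λ_{\,/}∧01    : prod = false, consts = true
--   L^Λ_{\,/}∧      : prod = false, consts = false
-- Each calculus works only with formulae of its own language: this is enforced
-- on the identity axiom, the 0-axiom and the cut formula (all other rules
-- only introduce subformulae of their conclusion's formulae / connectives whose
-- rules are present only when allowed).
L∧01 L∧01-pf L∧-pf : Lang
L∧01    = record { prod = true  ; consts = true  }
L∧01-pf = record { prod = false ; consts = true  }
L∧-pf   = record { prod = false ; consts = false }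

data _⊢[_]_ (H : Sequent → Set) (L : Lang) : Sequent → Set where
  hyp  : ∀ {s} → H s → H ⊢[ L ] s
  ax   : ∀ {A} → InLang L A → H ⊢[ L ] ((A ∷ []) ⇒ A)
  ax0  : ∀ {Γ Δ C} → T (consts L) → All (InLang L) Γ → All (InLang L) Δ → InLang L C →
         H ⊢[ L ] ((Γ ++ 𝟘 ∷ Δ) ⇒ C)
  ax1  : T (consts L) → H ⊢[ L ] ([] ⇒ 𝟙)
  cut  : ∀ {Π Γ Δ A C} → InLang L A →
         H ⊢[ L ] (Π ⇒ A) → H ⊢[ L ] ((Γ ++ A ∷ Δ) ⇒ C) →
         H ⊢[ L ] ((Γ ++ Π ++ Δ) ⇒ C)
  ╲L   : ∀ {Π Γ Δ A B C} →
         H ⊢[ L ] (Π ⇒ A) → H ⊢[ L ] ((Γ ++ B ∷ Δ) ⇒ C) →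
         H ⊢[ L ] ((Γ ++ Π ++ (A ╲ B) ∷ Δ) ⇒ C)
  ╲R   : ∀ {Π A B} → H ⊢[ L ] ((A ∷ Π) ⇒ B) → H ⊢[ L ] (Π ⇒ (A ╲ B))
  ╱L   : ∀ {Π Γ Δ A B C} →
         H ⊢[ L ] (Π ⇒ A) → H ⊢[ L ] ((Γ ++ B ∷ Δ) ⇒ C) →
         H ⊢[ L ] ((Γ ++ (B ╱ A) ∷ Π ++ Δ) ⇒ C)
  ╱R   : ∀ {Π A B} → H ⊢[ L ] ((Π ++ A ∷ []) ⇒ B) → H ⊢[ L ] (Π ⇒ (B ╱ A))
  ·L   : ∀ {Γ Δ A B C} → T (prod L) →
         H ⊢[ L ] ((Γ ++ A ∷ B ∷ Δ) ⇒ C) → H ⊢[ L ] ((Γ ++ (A · B) ∷ Δ) ⇒ C)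
  ·R   : ∀ {Π Δ A B} → T (prod L) →
         H ⊢[ L ] (Π ⇒ A) → H ⊢[ L ] (Δ ⇒ B) → H ⊢[ L ] ((Π ++ Δ) ⇒ (A · B))
  ∧L₁  : ∀ {Γ Δ A B C} → H ⊢[ L ] ((Γ ++ A ∷ Δ) ⇒ C) → H ⊢[ L ] ((Γ ++ (A ∧ B) ∷ Δ) ⇒ C)
  ∧L₂  : ∀ {Γ Δ A B C} → H ⊢[ L ] ((Γ ++ A ∷ Δ) ⇒ C) → H ⊢[ L ] ((Γ ++ (B ∧ A) ∷ Δ) ⇒ C)
  ∧R   : ∀ {Π A B} → H ⊢[ L ] (Π ⇒ A) → H ⊢[ L ] (Π ⇒ B) → H ⊢[ L ] (Π ⇒ (A ∧ B))
  𝟙L   : ∀ {Γ Δ C} → T (consts L) →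
         H ⊢[ L ] ((Γ ++ Δ) ⇒ C) → H ⊢[ L ] ((Γ ++ 𝟙 ∷ Δ) ⇒ C)

-- A canonical model argument. Fix a product-free language L and read a formula A
-- as the set ⟦ A ⟧ of L-antecedents Γ, built so that for A in L, Γ ∈ ⟦ A ⟧ iff
-- Γ ⇒ A is derivable from H in the calculus of L: variables by derivability, \ and /
-- as residuals, ∧ as intersection, and 0, 1 and · as the closures of ∅, {Λ} and the
-- concatenation ⟦ A ⟧⟦ B ⟧, where a set's closure consists of the antecedents
-- accepted by every L-context that accepts all its members. Every rule of the full
-- calculus, cut included, preserves validity in this model, so a sequent of L derived
-- in the full calculus is valid there and hence, by the truth lemma, derivable in the
-- calculus of L. No cut elimination is needed.
{-# OPTIONS --safe #-}
module Submission where

open import Defs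
open import Level using (0ℓ)
open import Data.Bool using (T)
open import Data.Empty using (⊥-elim)
open import Data.Unit using (tt)
open import Data.Product using (_×_; _,_; proj₁; proj₂)
open import Data.List using (List; []; _∷_; _++_)
open import Data.List.Properties using (++-assoc; ++-identityʳ)
open import Data.List.Relation.Unary.All using (All; []; _∷_)
open import Data.List.Relation.Unary.All.Properties using (++⁺)
open import Relation.Nullary using (¬_)
open import Relation.Unary using (Pred; _⊆_; ∅; ｛_｝; _∩_)
open import Relation.Binary.PropositionalEquality using (_≡_; refl; sym; cong; subst)
open Relation.Binary.PropositionalEquality.≡-Reasoning

++-regroup : ∀ {A : Set} (Φ′ Φ Γ Ψ Ψ′ : List A) →
             Φ′ ++ (Φ ++ Γ ++ Ψ) ++ Ψ′ ≡ (Φ′ ++ Φ) ++ Γ ++ (Ψ ++ Ψ′)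
++-regroup Φ′ Φ Γ Ψ Ψ′ = begin
  Φ′ ++ (Φ ++ Γ ++ Ψ) ++ Ψ′   ≡⟨ cong (Φ′ ++_) (++-assoc Φ (Γ ++ Ψ) Ψ′) ⟩
  Φ′ ++ Φ ++ (Γ ++ Ψ) ++ Ψ′   ≡⟨ cong (λ Θ → Φ′ ++ Φ ++ Θ) (++-assoc Γ Ψ Ψ′) ⟩
  Φ′ ++ Φ ++ Γ ++ Ψ ++ Ψ′     ≡⟨ sym (++-assoc Φ′ Φ (Γ ++ Ψ ++ Ψ′)) ⟩
  (Φ′ ++ Φ) ++ Γ ++ Ψ ++ Ψ′   ∎

++-[]-right : ∀ {A : Set} (Φ Γ : List A) → Φ ++ Γ ++ [] ≡ Φ ++ Γ
++-[]-right Φ Γ = cong (Φ ++_) (++-identityʳ Γ)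

module CanonicalModel (H : Sequent → Set) (L : Lang) where

  Ctx : Set
  Ctx = List Fm

  Phase : Set₁
  Phase = Pred Ctx 0ℓ

  InL : Fm → Set
  InL = InLang L

  InL* : Phase
  InL* = All InL

  _⊢_ : Ctx → Fm → Set
  Γ ⊢ C = H ⊢[ L ] (Γ ⇒ C)

  infix 4 _⊢_

  Plug : Ctx → Ctx → Fm → Phase
  Plug Φ Ψ C Δ = Φ ++ Δ ++ Ψ ⊢ C

  -- Only contexts of L are tested, which keeps every derivation produced in the
  -- language of L.
  closure : Phase → Phase
  closure X Γ = InL* Γ ×
    (∀ {Φ Ψ C} → InL* Φ → InL* Ψ → InL C → X ⊆ Plug Φ Ψ C → Plug Φ Ψ C Γ)

  Closed : Phase → Set
  Closed X = closure X ⊆ X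

  closure-mono : ∀ {X Y} → X ⊆ Y → closure X ⊆ closure Y
  closure-mono X⊆Y (Γ∈L , acc) = Γ∈L , λ Φ∈L Ψ∈L C∈L Y⊆ → acc Φ∈L Ψ∈L C∈L (λ x → Y⊆ (X⊆Y x))

  closure-closed : ∀ X → Closed (closure X)
  closure-closed X (Γ∈L , acc) =
    Γ∈L , λ Φ∈L Ψ∈L C∈L X⊆ → acc Φ∈L Ψ∈L C∈L (λ (_ , acc′) → acc′ Φ∈L Ψ∈L C∈L X⊆)

  closure-elim : ∀ {X Y Γ Φ Ψ} → Closed X → closure Y Γ → InL* Φ → InL* Ψ →
                 (∀ {Δ} → Y Δ → X (Φ ++ Δ ++ Ψ)) → X (Φ ++ Γ ++ Ψ)
  closure-elim {Γ = Γ} {Φ} {Ψ} X-closed (Γ∈L , acc) Φ∈L Ψ∈L Y⊆X =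
    X-closed (++⁺ Φ∈L (++⁺ Γ∈L Ψ∈L) , λ {Φ′} {Ψ′} {C} Φ′∈L Ψ′∈L C∈L X⊆ →
      subst (_⊢ C) (sym (++-regroup Φ′ Φ Γ Ψ Ψ′))
        (acc (++⁺ Φ′∈L Φ∈L) (++⁺ Ψ∈L Ψ′∈L) C∈L
          (λ {Δ} y → subst (_⊢ C) (++-regroup Φ′ Φ Δ Ψ Ψ′) (X⊆ (Y⊆X y)))))

  data _⊙_ (X Y : Phase) : Phase where
    _∙_ : ∀ {Δ₁ Δ₂} → X Δ₁ → Y Δ₂ → (X ⊙ Y) (Δ₁ ++ Δ₂)

  ⟦_⟧ : Fm → Phase
  ⟦ var n ⟧ Γ = InL* Γ × Γ ⊢ var n
  ⟦ 𝟘 ⟧ = closure ∅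
  ⟦ 𝟙 ⟧ = closure ｛ [] ｝
  ⟦ A · B ⟧ = closure (⟦ A ⟧ ⊙ ⟦ B ⟧)
  ⟦ A ╲ B ⟧ Γ = InL* Γ × (∀ {Δ} → ⟦ A ⟧ Δ → ⟦ B ⟧ (Δ ++ Γ))
  ⟦ B ╱ A ⟧ Γ = InL* Γ × (∀ {Δ} → ⟦ A ⟧ Δ → ⟦ B ⟧ (Γ ++ Δ))
  ⟦ A ∧ B ⟧ = ⟦ A ⟧ ∩ ⟦ B ⟧

  ⟦⟧⊆InL* : ∀ A → ⟦ A ⟧ ⊆ InL*
  ⟦⟧⊆InL* (var _) = proj₁
  ⟦⟧⊆InL* 𝟘 = proj₁
  ⟦⟧⊆InL* 𝟙 = proj₁
  ⟦⟧⊆InL* (_ · _) = proj₁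
  ⟦⟧⊆InL* (_ ╲ _) = proj₁
  ⟦⟧⊆InL* (_ ╱ _) = proj₁
  ⟦⟧⊆InL* (A ∧ _) (a , _) = ⟦⟧⊆InL* A a

  ⟦⟧-closed : ∀ A → Closed ⟦ A ⟧
  ⟦⟧-closed (var n) {Γ} (Γ∈L , acc) =
    Γ∈L , subst (_⊢ var n) (++-identityʳ Γ)
            (acc [] [] tt λ {Δ} (_ , ⊢var) → subst (_⊢ var n) (sym (++-identityʳ Δ)) ⊢var)
  ⟦⟧-closed 𝟘 = closure-closed ∅
  ⟦⟧-closed 𝟙 = closure-closed ｛ [] ｝
  ⟦⟧-closed (A · B) = closure-closed (⟦ A ⟧ ⊙ ⟦ B ⟧)
  ⟦⟧-closed (A ╲ B) {Γ} Γ∈cl@(Γ∈L , _) = Γ∈L , λ {Δ} a →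
    subst ⟦ B ⟧ (++-[]-right Δ Γ)
      (closure-elim (⟦⟧-closed B) Γ∈cl (⟦⟧⊆InL* A a) []
        λ {Θ} (_ , f) → subst ⟦ B ⟧ (sym (++-[]-right Δ Θ)) (f a))
  ⟦⟧-closed (B ╱ A) Γ∈cl@(Γ∈L , _) = Γ∈L , λ a →
    closure-elim {Φ = []} (⟦⟧-closed B) Γ∈cl [] (⟦⟧⊆InL* A a) λ (_ , f) → f a
  ⟦⟧-closed (A ∧ B) Γ∈cl =
    ⟦⟧-closed A (closure-mono proj₁ Γ∈cl) , ⟦⟧-closed B (closure-mono proj₂ Γ∈cl)

  module TruthLemma (no-product : ¬ T (Lang.prod L)) where

    mutual
      ⟦⟧⇒⊢ : ∀ A {Γ} → InL A → ⟦ A ⟧ Γ → Γ ⊢ A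
      ⟦⟧⇒⊢ (var n) _ (_ , ⊢var) = ⊢var
      ⟦⟧⇒⊢ 𝟘 {Γ} c (_ , acc) = subst (_⊢ 𝟘) (++-identityʳ Γ) (acc [] [] c λ ())
      ⟦⟧⇒⊢ 𝟙 {Γ} c (_ , acc) = subst (_⊢ 𝟙) (++-identityʳ Γ) (acc [] [] c λ { refl → ax1 c })
      ⟦⟧⇒⊢ (A · B) (p , _) _ = ⊥-elim (no-product p)
      ⟦⟧⇒⊢ (A ╲ B) (A∈L , B∈L) (_ , f) = ╲R (⟦⟧⇒⊢ B B∈L (f (axiom-realizes A A∈L)))
      ⟦⟧⇒⊢ (B ╱ A) (B∈L , A∈L) (_ , f) = ╱R (⟦⟧⇒⊢ B B∈L (f (axiom-realizes A A∈L)))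
      ⟦⟧⇒⊢ (A ∧ B) (A∈L , B∈L) (a , b) = ∧R (⟦⟧⇒⊢ A A∈L a) (⟦⟧⇒⊢ B B∈L b)

      ⊢⇒⟦⟧ : ∀ A {Γ} → InL A → InL* Γ → Γ ⊢ A → ⟦ A ⟧ Γ
      ⊢⇒⟦⟧ (var n) _ Γ∈L ⊢A = Γ∈L , ⊢A
      ⊢⇒⟦⟧ 𝟘 c Γ∈L ⊢𝟘 = Γ∈L , λ Φ∈L Ψ∈L C∈L _ → cut c ⊢𝟘 (ax0 c Φ∈L Ψ∈L C∈L)
      ⊢⇒⟦⟧ 𝟙 c Γ∈L ⊢𝟙 = Γ∈L , λ {Φ} {Ψ} _ _ _ accepts →
        cut {Γ = Φ} {Δ = Ψ} c ⊢𝟙 (𝟙L {Γ = Φ} c (accepts refl))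
      ⊢⇒⟦⟧ (A · B) (p , _) _ _ = ⊥-elim (no-product p)
      ⊢⇒⟦⟧ (A ╲ B) {Γ} A╲B∈L@(A∈L , B∈L) Γ∈L ⊢A╲B = Γ∈L , λ {Δ} a →
        ⊢⇒⟦⟧ B B∈L (++⁺ (⟦⟧⊆InL* A a) Γ∈L)
          (subst (_⊢ B) (++-[]-right Δ Γ)
            (cut {Γ = Δ} {Δ = []} A╲B∈L ⊢A╲B (╲L {Γ = []} (⟦⟧⇒⊢ A A∈L a) (ax B∈L))))
      ⊢⇒⟦⟧ (B ╱ A) {Γ} B╱A∈L@(B∈L , A∈L) Γ∈L ⊢B╱A = Γ∈L , λ {Δ} a →
        ⊢⇒⟦⟧ B B∈L (++⁺ Γ∈L (⟦⟧⊆InL* A a))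
          (subst (_⊢ B) (++-[]-right Γ Δ)
            (cut {Γ = []} B╱A∈L ⊢B╱A (╱L {Γ = []} {Δ = []} (⟦⟧⇒⊢ A A∈L a) (ax B∈L))))
      ⊢⇒⟦⟧ (A ∧ B) {Γ} A∧B∈L@(A∈L , B∈L) Γ∈L ⊢A∧B =
        ⊢⇒⟦⟧ A A∈L Γ∈L (project (∧L₁ {Γ = []} {Δ = []} (ax A∈L))) ,
        ⊢⇒⟦⟧ B B∈L Γ∈L (project (∧L₂ {Γ = []} {Δ = []} (ax B∈L)))
        where
          project : ∀ {D} → A ∧ B ∷ [] ⊢ D → Γ ⊢ D
          project {D} ⊢D = subst (_⊢ D) (++-identityʳ Γ) (cut {Γ = []} {Δ = []} A∧B∈L ⊢A∧B ⊢D)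

      axiom-realizes : ∀ A → InL A → ⟦ A ⟧ (A ∷ [])
      axiom-realizes A A∈L = ⊢⇒⟦⟧ A A∈L (A∈L ∷ []) (ax A∈L)

  data ⟦_⟧* : Ctx → Phase where
    []  : ⟦ [] ⟧* []
    _∷_ : ∀ {A Γ Δ₁ Δ₂} → ⟦ A ⟧ Δ₁ → ⟦ Γ ⟧* Δ₂ → ⟦ A ∷ Γ ⟧* (Δ₁ ++ Δ₂)

  ⟦⟧*⊆InL* : ∀ {Γ} → ⟦ Γ ⟧* ⊆ InL*
  ⟦⟧*⊆InL* [] = []
  ⟦⟧*⊆InL* (_∷_ {A} a as) = ++⁺ (⟦⟧⊆InL* A a) (⟦⟧*⊆InL* as)

  ⟦⟧*-++⁻ : ∀ Γ₁ {Γ₂} → ⟦ Γ₁ ++ Γ₂ ⟧* ⊆ ⟦ Γ₁ ⟧* ⊙ ⟦ Γ₂ ⟧*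
  ⟦⟧*-++⁻ [] as = [] ∙ as
  ⟦⟧*-++⁻ (_ ∷ Γ₁) (_∷_ {Δ₁ = Δ} a as) with ⟦⟧*-++⁻ Γ₁ as
  ... | _∙_ {Δ₁} {Δ₂} as₁ as₂ = subst (⟦ _ ⟧* ⊙ ⟦ _ ⟧*) (++-assoc Δ Δ₁ Δ₂) ((a ∷ as₁) ∙ as₂)

  ⟦⟧*-++⁺ : ∀ {Γ₁ Γ₂ Δ₁ Δ₂} → ⟦ Γ₁ ⟧* Δ₁ → ⟦ Γ₂ ⟧* Δ₂ → ⟦ Γ₁ ++ Γ₂ ⟧* (Δ₁ ++ Δ₂)
  ⟦⟧*-++⁺ [] bs = bs
  ⟦⟧*-++⁺ {Δ₂ = Δ₂} (_∷_ {Δ₁ = Δ} {Δ′} a as) bs =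
    subst ⟦ _ ⟧* (sym (++-assoc Δ Δ′ Δ₂)) (a ∷ ⟦⟧*-++⁺ as bs)

  Valid : Sequent → Set
  Valid (Γ ⇒ C) = ⟦ Γ ⟧* ⊆ ⟦ C ⟧

  module Soundness (no-product : ¬ T (Lang.prod L))
                   (H⊆L : ∀ h → H h → SeqInLang L h) where

    open TruthLemma no-product

    cut-⟦⟧* : ∀ {C} Γ Φ {Δ} → InL* Γ → ⟦ Γ ⟧* Δ → Φ ++ Γ ⊢ C → Φ ++ Δ ⊢ C
    cut-⟦⟧* [] _ [] [] ⊢C = ⊢C
    cut-⟦⟧* {C} (A ∷ Γ) Φ (A∈L ∷ Γ∈L) (_∷_ {Δ₁ = Δ₁} {Δ₂} a as) ⊢C =
      subst (_⊢ C) (++-assoc Φ Δ₁ Δ₂)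
        (cut-⟦⟧* Γ (Φ ++ Δ₁) Γ∈L as
          (subst (_⊢ C) (sym (++-assoc Φ Δ₁ Γ)) (cut {Γ = Φ} A∈L (⟦⟧⇒⊢ A A∈L a) ⊢C)))

    hyp-valid : ∀ {s} → H s → Valid s
    hyp-valid {Γ ⇒ C} h as with H⊆L _ h
    ... | Γ∈L , C∈L = ⊢⇒⟦⟧ C C∈L (⟦⟧*⊆InL* as) (cut-⟦⟧* Γ [] Γ∈L as (hyp h))

    sound : ∀ {s} → H ⊢[ L∧01 ] s → Valid s
    sound (hyp h) = hyp-valid h
    sound (ax {A} _) (a ∷ []) = subst ⟦ A ⟧ (sym (++-identityʳ _)) a
    sound (ax0 {Γ} {C = C} _ _ _ _) as with ⟦⟧*-++⁻ Γ as
    ... | as₁ ∙ (z ∷ as₂) = closure-elim (⟦⟧-closed C) z (⟦⟧*⊆InL* as₁) (⟦⟧*⊆InL* as₂) λ ()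
    sound (ax1 _) [] = [] , λ _ _ _ accepts → accepts refl
    sound (cut {Π} {Γ} _ ⊢A ⊢C) as with ⟦⟧*-++⁻ Γ as
    ... | as₁ ∙ as′ with ⟦⟧*-++⁻ Π as′
    ... | as₂ ∙ as₃ = sound ⊢C (⟦⟧*-++⁺ as₁ (sound ⊢A as₂ ∷ as₃))
    sound (╲L {Π} {Γ} {C = C} ⊢A ⊢C) as with ⟦⟧*-++⁻ Γ as
    ... | _∙_ {Δ₁} as₁ as′ with ⟦⟧*-++⁻ Π as′
    ... | _∙_ {Δ₂} as₂ (_∷_ {Δ₁ = Δ₃} {Δ₄} (_ , f) as₃) =
      subst ⟦ C ⟧ (cong (Δ₁ ++_) (++-assoc Δ₂ Δ₃ Δ₄))
        (sound ⊢C (⟦⟧*-++⁺ as₁ (f (sound ⊢A as₂) ∷ as₃)))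
    sound (╲R ⊢B) as = ⟦⟧*⊆InL* as , λ a → sound ⊢B (a ∷ as)
    sound (╱L {Π} {Γ} {C = C} ⊢A ⊢C) as with ⟦⟧*-++⁻ Γ as
    ... | _∙_ {Δ₁} as₁ (_∷_ {Δ₁ = Δ₂} (_ , f) as′) with ⟦⟧*-++⁻ Π as′
    ... | _∙_ {Δ₃} {Δ₄} as₂ as₃ =
      subst ⟦ C ⟧ (cong (Δ₁ ++_) (++-assoc Δ₂ Δ₃ Δ₄))
        (sound ⊢C (⟦⟧*-++⁺ as₁ (f (sound ⊢A as₂) ∷ as₃)))
    sound (╱R {B = B} ⊢B) {Δ} as = ⟦⟧*⊆InL* as , λ {Θ} a →
      subst ⟦ B ⟧ (++-[]-right Δ Θ) (sound ⊢B (⟦⟧*-++⁺ as (a ∷ [])))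
    sound (·L {Γ} {C = C} _ ⊢C) as with ⟦⟧*-++⁻ Γ as
    ... | _∙_ {Δ₁} as₁ (_∷_ {Δ₂ = Δ₂} z as₂) =
      closure-elim (⟦⟧-closed C) z (⟦⟧*⊆InL* as₁) (⟦⟧*⊆InL* as₂)
        λ { (_∙_ {Θ₁} {Θ₂} a b) → subst ⟦ C ⟧ (cong (Δ₁ ++_) (sym (++-assoc Θ₁ Θ₂ Δ₂)))
                                    (sound ⊢C (⟦⟧*-++⁺ as₁ (a ∷ b ∷ as₂))) }
    sound (·R {Π} _ ⊢A ⊢B) as with ⟦⟧*-++⁻ Π as
    ... | as₁ ∙ as₂ = ⟦⟧*⊆InL* as , λ _ _ _ accepts → accepts (sound ⊢A as₁ ∙ sound ⊢B as₂)
    sound (∧L₁ {Γ} ⊢C) as with ⟦⟧*-++⁻ Γ as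
    ... | as₁ ∙ ((a , _) ∷ as₂) = sound ⊢C (⟦⟧*-++⁺ as₁ (a ∷ as₂))
    sound (∧L₂ {Γ} ⊢C) as with ⟦⟧*-++⁻ Γ as
    ... | as₁ ∙ ((_ , a) ∷ as₂) = sound ⊢C (⟦⟧*-++⁺ as₁ (a ∷ as₂))
    sound (∧R ⊢A ⊢B) as = sound ⊢A as , sound ⊢B as
    sound (𝟙L {Γ} {C = C} _ ⊢C) as with ⟦⟧*-++⁻ Γ as
    ... | as₁ ∙ (z ∷ as₂) = closure-elim (⟦⟧-closed C) z (⟦⟧*⊆InL* as₁) (⟦⟧*⊆InL* as₂)
                              λ { refl → sound ⊢C (⟦⟧*-++⁺ as₁ as₂) }

    ⟦⟧*-self : ∀ {Γ} → InL* Γ → ⟦ Γ ⟧* Γ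
    ⟦⟧*-self [] = []
    ⟦⟧*-self {A ∷ _} (A∈L ∷ Γ∈L) = axiom-realizes A A∈L ∷ ⟦⟧*-self Γ∈L

conservative : ∀ H L → ¬ T (Lang.prod L) → (∀ h → H h → SeqInLang L h) →
               ∀ s → SeqInLang L s → H ⊢[ L∧01 ] s → H ⊢[ L ] s
conservative H L no-product H⊆L (Γ ⇒ C) (Γ∈L , C∈L) ⊢s =
  ⟦⟧⇒⊢ C C∈L (sound ⊢s (⟦⟧*-self Γ∈L))
  where open CanonicalModel H L
        open TruthLemma no-product
        open Soundness no-product H⊆L

theorem6p1 : (H : Sequent → Set) (s : Sequent) →
    (∀ h → H h → SeqInLang L∧01-pf h) → SeqInLang L∧01-pf s →
    H ⊢[ L∧01 ] s →
    (H ⊢[ L∧01-pf ] s)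
      × ((∀ h → H h → SeqInLang L∧-pf h) → SeqInLang L∧-pf s → H ⊢[ L∧-pf ] s)
theorem6p1 H s H⊆L s∈L ⊢s =
  conservative H L∧01-pf (λ ()) H⊆L s s∈L ⊢s ,
  λ H⊆L′ s∈L′ → conservative H L∧-pf (λ ()) H⊆L′ s s∈L′ ⊢s
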